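{- Let $\{(X_n,C_n,f_n(q))\}_{n\ge1}$ and $\{(Y_n,C_n,g_n(q))\}_{n\ge1}$ be two Lyndon-like families of instances of the cyclic sieving phenomenon (with the same cyclic group $C_n$ of order $n$ acting on $X_n$ and on $Y_n$) having the same Lyndon parameters. Then for each $n$ there is a bijection $\psi_n:X_n\to Y_n$ such that $\psi_n(g\cdot x)=g\cdot\psi_n(x)$ for all $g\in C_n$ and $x\in X_n$.
   Context: A triple $(X,C_n,f(q))$, $C_n=\langle g\rangle$ cyclic of order $n$ acting on the finite set $X$, $f$ a polynomial with non-negative integer coefficients, exhibits the cyclic sieving phenomenon if $f(\omega_n^k)=|\{x\in X: g^k\cdot x=x\}|$ for all $k\in\{1,\dots,n\}$, $\omega_n=e^{2\pi i/n}$. A family $\{(X_n,C_n,f_n(q))\}_{n\ge1}$ of such instances is Lyndon-like if $f_{n/m}(1)=f_n(e^{2\pi i/m})$ whenever $m\mid n$. The Lyndon parameters of a Lyndon-like family are the unique non-negative integers $t_d$ with $|X_n|=\sum_{d\mid n}d\,t_d$ for all $n\ge 1$ (here $n\,t_n$ is the number of elements of $X_n$ lying in $C_n$-orbits of size $n$). -}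

module Defs where

open import Level using (0ℓ)
open import Algebra.Bundles using (CommutativeRing)
open import Data.Nat using (ℕ; zero; suc; _≤_)
import Data.Nat as ℕ
open import Data.Nat.Divisibility using (_∣_; _∣?_)
open import Data.Fin using (Fin; _≟_)
open import Data.List using (List; []; _∷_; length; filter; allFin; applyUpTo; map)
open import Data.Nat.ListAction using (sum)
open import Data.Product using (Σ; _×_)
open import Data.Sum using (_⊎_)
open import Relation.Nullary using (¬_)
open import Relation.Binary.PropositionalEquality using (_≡_)
open import Function.Bundles using (_⤖_; Bijection)

iter : {A : Set} → (A → A) → ℕ → A → A
iter f zero    x = x
iter f (suc k) x = f (iter f k x)

divisorSum : ℕ → (ℕ → ℕ) → ℕ
divisorSum n h = sum (map h (filter (λ d → d ∣? n) (applyUpTo suc n)))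

fixCount : {N : ℕ} → (Fin N → Fin N) → ℕ → ℕ
fixCount {N} σ k = length (filter (λ x → iter σ k x ≟ x) (allFin N))

-- The ambient "complex numbers": a characteristic-0 integral domain K
-- together with, for every n ≥ 1, a primitive n-th root of unity ω n
-- (playing the role of ω_n = e^{2πi/n}).

module RingOps (R : CommutativeRing 0ℓ 0ℓ) where
  open CommutativeRing R

  fromℕ : ℕ → Carrier
  fromℕ zero    = 0#
  fromℕ (suc n) = 1# + fromℕ n

  pow : Carrier → ℕ → Carrier
  pow x zero    = 1#
  pow x (suc k) = x * pow x k

  -- evaluation of a polynomial given by its coefficient list
  -- (constant term first) with non-negative integer coefficients
  eval : List ℕ → Carrier → Carrier
  eval []       x = 0#
  eval (a ∷ as) x = fromℕ a + x * eval as x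

record CycloDomain : Set₁ where
  field
    K-ring : CommutativeRing 0ℓ 0ℓ
  open CommutativeRing K-ring public
  open RingOps K-ring public
  field
    domain    : ∀ x y → x * y ≈ 0# → x ≈ 0# ⊎ y ≈ 0#
    charZero  : ∀ n → fromℕ n ≈ 0# → n ≡ 0
    ω         : ℕ → Carrier
    ω-root    : ∀ n → 1 ≤ n → pow (ω n) n ≈ 1#
    ω-prim    : ∀ n k → 1 ≤ n → 1 ≤ k → suc k ≤ n → ¬ (pow (ω n) k ≈ 1#)

-- X_n is represented as Fin (size n); the generator g of C_n acts by
-- act n, with g^n acting trivially.  Index n = 0 is ignored.

record CSPFamily (K : CycloDomain) : Set where
  open CycloDomain K
  field
    size  : ℕ → ℕ
    act   : (n : ℕ) → Fin (size n) → Fin (size n)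
    poly  : ℕ → List ℕ
    order : ∀ n → 1 ≤ n → ∀ x → iter (act n) n x ≡ x
    csp   : ∀ n k → 1 ≤ n → 1 ≤ k → k ≤ n →
            eval (poly n) (pow (ω n) k) ≈ fromℕ (fixCount (act n) k)

module _ {K : CycloDomain} where
  open CycloDomain K

  -- Lyndon-like: f_{n/m}(1) = f_n(e^{2πi/m}) whenever m ∣ n; written with
  -- n = m * d, n/m = d and e^{2πi/m} = ω_n^{n/m} = ω_n^d.
  LyndonLike : CSPFamily K → Set
  LyndonLike F = ∀ m d → 1 ≤ m → 1 ≤ d →
    eval (poly d) 1# ≈ eval (poly (m ℕ.* d)) (pow (ω (m ℕ.* d)) d)
    where open CSPFamily F

  HasLyndonParams : CSPFamily K → (ℕ → ℕ) → Set
  HasLyndonParams F t = ∀ n → 1 ≤ n → size n ≡ divisorSum n (λ d → d ℕ.* t d)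
    where open CSPFamily F

  EquivariantBijection : (F G : CSPFamily K) → ℕ → Set
  EquivariantBijection F G n =
    Σ (Fin (CSPFamily.size F n) ⤖ Fin (CSPFamily.size G n)) λ ψ →
      ∀ k x → Bijection.to ψ (iter (CSPFamily.act F n) k x)
              ≡ iter (CSPFamily.act G n) k (Bijection.to ψ x)

module Submission where

-- A finite C_n-set is determined up to isomorphism by the numbers of points fixed by
-- g^d for d ∣ n.  For a Lyndon-like family these numbers are forced: writing n = m d,
--   #Fix(g^d, X_n) = f_n(ω_n^d) = f_d(1) = f_d(ω_d^d) = #Fix(g^d, X_d) = |X_d|,
-- and equal Lyndon parameters give |X_d| = |Y_d| = Σ_{e ∣ d} e t_e.
--
-- Induction on the size of the set then peels off, from both sides,
-- an orbit of the least size that occurs, giving `equivariant-bijection`.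

open import Defs
open import Data.Nat using (ℕ; zero; suc; _+_; _*_; _∸_; _≤_; _<_; z≤n; s≤s; s≤s⁻¹; z<s; NonZero; >-nonZero; _≤?_; _<?_)
open import Data.Nat.Properties
  using (+-comm; +-cancelʳ-≡; m<m+n; ≤-pred; n≤0⇒n≡0; ≮⇒≥; <⇒≢; ≤-refl; ≤-reflexive; ≤-trans;
         ≤-<-trans; n≤1+n; m≤n+m; m≤n*m; m≤n⇒m≤1+n; m≤n⇒m<n∨m≡n; m<n⇒0<n∸m; m∸n≤m; m∸n+n≡m;
         <⇒≤; +-commutativeSemigroup; module ≤-Reasoning)
open import Data.Nat.Divisibility using (_∣_; _∣?_; divides; ∣-refl; ∣⇒≤; m%n≡0⇒n∣m)
open import Data.Nat.DivMod using (_%_; _/_; m≡m%n+[m/n]*n; m%n<n)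
open import Algebra.Properties.CommutativeSemigroup +-commutativeSemigroup using (interchange)
open import Data.Fin using (Fin; zero; suc; _≟_)
open import Data.Bool using (Bool; true; false; _∧_; _∨_; not; if_then_else_)
open import Data.Bool.Properties using (∧-zeroʳ; ∧-identityʳ; ⇔→≡)
open import Data.List using ([]; _∷_; length; filter; tabulate)
open import Data.Product using (Σ; _×_; _,_; proj₁; proj₂)
open import Data.Sum using (_⊎_; inj₁; inj₂)
open import Data.Empty using (⊥; ⊥-elim)
open import Relation.Nullary using (¬_; Dec; yes; no; does)
open import Relation.Nullary.Decidable using (dec-true; does-≡; map′; _×-dec_)
open import Relation.Binary.PropositionalEquality
  using (_≡_; refl; sym; trans; cong; cong₂; subst; module ≡-Reasoning)
open import Function using (_∘_; id)
open import Function.Bundles using (_⤖_; Bijection; mk⇔; mk↔ₛ′)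
open import Function.Properties.Inverse using (↔⇒⤖)

does-⇔ : ∀ {P Q : Set} (P? : Dec P) (Q? : Dec Q) → (P → Q) → (Q → P) → does P? ≡ does Q?
does-⇔ P? Q? to from = does-≡ P? (map′ from to Q?)

from-does : ∀ {P : Set} (P? : Dec P) → does P? ≡ true → P
from-does (yes p) _ = p

bool-⇔ : ∀ {a b : Bool} → (a ≡ true → b ≡ true) → (b ≡ true → a ≡ true) → a ≡ b
bool-⇔ to from = ⇔→≡ {z = true} (mk⇔ to from)

indicator : Bool → ℕ
indicator b = if b then 1 else 0

count : ∀ {N} → (Fin N → Bool) → ℕ
count {zero}  P = 0
count {suc N} P = indicator (P zero) + count (P ∘ suc)

count-cong : ∀ {N} {P Q : Fin N → Bool} → (∀ x → P x ≡ Q x) → count P ≡ count Q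
count-cong {zero}  P≡Q = refl
count-cong {suc N} P≡Q = cong₂ _+_ (cong indicator (P≡Q zero)) (count-cong (P≡Q ∘ suc))

count-empty : ∀ {N} {P : Fin N → Bool} → (∀ x → P x ≡ false) → count P ≡ 0
count-empty {zero}  P≡false = refl
count-empty {suc N} P≡false rewrite P≡false zero = count-empty (P≡false ∘ suc)

count-full : ∀ {N} {P : Fin N → Bool} → (∀ x → P x ≡ true) → count P ≡ N
count-full {zero}  P≡true = refl
count-full {suc N} P≡true rewrite P≡true zero = cong suc (count-full (P≡true ∘ suc))

count-pos : ∀ {N} (P : Fin N → Bool) x → P x ≡ true → 0 < count P
count-pos {suc N} P zero    Px rewrite Px = z<s
count-pos {suc N} P (suc x) Px = ≤-trans (count-pos (P ∘ suc) x Px) (m≤n+m _ (indicator (P zero)))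

count-witness : ∀ {N} (P : Fin N → Bool) → 0 < count P → Σ (Fin N) λ x → P x ≡ true
count-witness {suc N} P pos with P zero in P0
... | true  = zero , P0
... | false = let x , Px = count-witness (P ∘ suc) pos in suc x , Px

count-split : ∀ {N} (P Q : Fin N → Bool) →
  count P ≡ count (λ x → P x ∧ not (Q x)) + count (λ x → P x ∧ Q x)
count-split {zero}  P Q = refl
count-split {suc N} P Q =
  trans (cong₂ _+_ (split (P zero) (Q zero)) (count-split (P ∘ suc) (Q ∘ suc)))
        (interchange (indicator (P zero ∧ not (Q zero))) (indicator (P zero ∧ Q zero))
                     (count (λ x → P (suc x) ∧ not (Q (suc x)))) (count (λ x → P (suc x) ∧ Q (suc x))))
  where
  split : ∀ a b → indicator a ≡ indicator (a ∧ not b) + indicator (a ∧ b)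
  split false _     = refl
  split true  true  = refl
  split true  false = refl

count-singleton : ∀ {N} (c : Fin N) → count (λ x → does (c ≟ x)) ≡ 1
count-singleton {suc N} zero    = cong suc (count-empty {N} {P = λ x → does (zero ≟ suc x)} (λ _ → refl))
count-singleton {suc N} (suc c) = trans (count-cong same) (count-singleton c)
  where same : ∀ x → does (suc c ≟ suc x) ≡ does (c ≟ x)
        same x with c ≟ x
        ... | yes _ = refl
        ... | no  _ = refl

-- `count` agrees with the list-based counting used in `fixCount`.
count-filter : ∀ {A : Set} {N} {P : A → Set} (P? : ∀ a → Dec (P a)) (f : Fin N → A) →
  length (filter P? (tabulate f)) ≡ count (λ i → does (P? (f i)))
count-filter {N = zero}  P? f = refl
count-filter {N = suc N} P? f with does (P? (f zero))
... | true  = cong suc (count-filter P? (f ∘ suc))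
... | false = count-filter P? (f ∘ suc)

module _ {Q : ℕ → Set} (Q? : ∀ e → Dec (Q e)) where

  private
    searchBelow : ∀ B → (Σ ℕ λ p → Q p × (∀ e → e < p → ¬ Q e)) ⊎ (∀ e → e < B → ¬ Q e)
    searchBelow zero = inj₂ (λ _ ())
    searchBelow (suc B) with searchBelow B
    ... | inj₁ least = inj₁ least
    ... | inj₂ none with Q? B
    ...   | yes QB = inj₁ (B , QB , none)
    ...   | no ¬QB = inj₂ noneBelow
      where noneBelow : ∀ e → e < suc B → ¬ Q e
            noneBelow e e<1+B with m≤n⇒m<n∨m≡n (s≤s⁻¹ e<1+B)
            ... | inj₁ e<B  = none e e<B
            ... | inj₂ refl = ¬QB

  least : ∀ D → Q D → Σ ℕ λ p → Q p × (∀ e → e < p → ¬ Q e)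
  least D QD with searchBelow (suc D)
  ... | inj₁ found = found
  ... | inj₂ none  = ⊥-elim (none D ≤-refl QD)

module Iteration {A : Set} (σ : A → A) where

  iter-+ : ∀ a b x → iter σ (a + b) x ≡ iter σ a (iter σ b x)
  iter-+ zero    b x = refl
  iter-+ (suc a) b x = cong σ (iter-+ a b x)

  iter-σ : ∀ a x → iter σ a (σ x) ≡ σ (iter σ a x)
  iter-σ zero    x = refl
  iter-σ (suc a) x = cong σ (iter-σ a x)

  iter-comm : ∀ a b x → iter σ a (iter σ b x) ≡ iter σ b (iter σ a x)
  iter-comm a b x = begin
    iter σ a (iter σ b x) ≡⟨ iter-+ a b x ⟨
    iter σ (a + b) x      ≡⟨ cong (λ c → iter σ c x) (+-comm a b) ⟩
    iter σ (b + a) x      ≡⟨ iter-+ b a x ⟩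
    iter σ b (iter σ a x) ∎
    where open ≡-Reasoning

  iter-* : ∀ p x → iter σ p x ≡ x → ∀ q → iter σ (q * p) x ≡ x
  iter-* p x back zero    = refl
  iter-* p x back (suc q) = trans (iter-+ p (q * p) x) (trans (cong (iter σ p) (iter-* p x back q)) back)

  iter-% : ∀ p x → iter σ p x ≡ x → .{{_ : NonZero p}} → ∀ k → iter σ k x ≡ iter σ (k % p) x
  iter-% p x back k = begin
    iter σ k x                              ≡⟨ cong (λ c → iter σ c x) (m≡m%n+[m/n]*n k p) ⟩
    iter σ (k % p + k / p * p) x            ≡⟨ iter-+ (k % p) (k / p * p) x ⟩
    iter σ (k % p) (iter σ (k / p * p) x)   ≡⟨ cong (iter σ (k % p)) (iter-* p x back (k / p)) ⟩
    iter σ (k % p) x                        ∎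
    where open ≡-Reasoning

  record Period (x : A) (d : ℕ) : Set where
    field
      positive : 1 ≤ d
      returns  : iter σ d x ≡ x
      minimal  : ∀ e → 1 ≤ e → e < d → ¬ (iter σ e x ≡ x)

    returns-only-at-0 : ∀ e → e < d → iter σ e x ≡ x → e ≡ 0
    returns-only-at-0 zero    _   _    = refl
    returns-only-at-0 (suc e) e<d back = ⊥-elim (minimal (suc e) (s≤s z≤n) e<d back)

    period-∣ : ∀ k → iter σ k x ≡ x → d ∣ k
    period-∣ k back =
      m%n≡0⇒n∣m k d (returns-only-at-0 (k % d) (m%n<n k d) (trans (sym (iter-% d x returns k)) back))
      where instance d≢0 : NonZero d
                     d≢0 = >-nonZero positive

    ∣-period : ∀ k → d ∣ k → iter σ k x ≡ x
    ∣-period k (divides q refl) = iter-* d x returns q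

  period-exists : (_≟ᴬ_ : ∀ (a b : A) → Dec (a ≡ b)) →
    ∀ x D → 1 ≤ D → iter σ D x ≡ x → Σ ℕ (Period x)
  period-exists _≟ᴬ_ x D 1≤D back with least (λ e → (1 ≤? e) ×-dec (iter σ e x ≟ᴬ x)) D (1≤D , back)
  ... | p , (1≤p , backp) , below = p , record
    { positive = 1≤p ; returns = backp ; minimal = λ e 1≤e e<p backe → below e e<p (1≤e , backe) }

iter-intertwine : ∀ {X Y : Set} (σ : X → X) (τ : Y → Y) (φ : X → Y) →
  (∀ x → φ (σ x) ≡ τ (φ x)) → ∀ k x → φ (iter σ k x) ≡ iter τ k (φ x)
iter-intertwine σ τ φ comm zero    x = refl
iter-intertwine σ τ φ comm (suc k) x = trans (comm (iter σ k x)) (cong τ (iter-intertwine σ τ φ comm k x))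

module FiniteOrder {A : Set} (σ : A → A) (n : ℕ) (1≤n : 1 ≤ n) (order : ∀ x → iter σ n x ≡ x) where
  open Iteration σ

  -- Some power of σ undoes σ (namely σ^(n-1)).
  inverse-power : Σ ℕ λ m → ∀ z → iter σ m (σ z) ≡ z
  inverse-power = undo n 1≤n order
    where
    undo : ∀ k → 1 ≤ k → (∀ x → iter σ k x ≡ x) → Σ ℕ λ m → ∀ z → iter σ m (σ z) ≡ z
    undo (suc m) _ back = m , λ z → trans (iter-σ m z) (back z)

  σ-injective : ∀ {a b} → σ a ≡ σ b → a ≡ b
  σ-injective {a} {b} σa≡σb =
    let m , undo = inverse-power in trans (sym (undo a)) (trans (cong (iter σ m) σa≡σb) (undo b))

  iter-injective : ∀ j {a b} → iter σ j a ≡ iter σ j b → a ≡ b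
  iter-injective zero    eq = eq
  iter-injective (suc j) eq = iter-injective j (σ-injective eq)

fixes : ∀ {N} → (Fin N → Fin N) → ℕ → Fin N → Bool
fixes σ k x = does (iter σ k x ≟ x)

fixedIn : ∀ {N} → (Fin N → Fin N) → (Fin N → Bool) → ℕ → ℕ
fixedIn σ A k = count (λ z → A z ∧ fixes σ k z)

Invariant : ∀ {N} → (Fin N → Fin N) → (Fin N → Bool) → Set
Invariant σ A = ∀ z → A (σ z) ≡ A z

invariant-iter : ∀ {N} {σ : Fin N → Fin N} {A} → Invariant σ A → ∀ i z → A (iter σ i z) ≡ A z
invariant-iter inv zero    z = refl
invariant-iter inv (suc i) z = trans (inv _) (invariant-iter inv i z)

_∖_ : ∀ {N} → (Fin N → Bool) → (Fin N → Bool) → Fin N → Bool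
(A ∖ O) z = A z ∧ not (O z)

∧-member : ∀ {a b : Bool} → a ∧ b ≡ true → a ≡ true × b ≡ true
∧-member {true} {true} _ = refl , refl

∖-member : ∀ {a o : Bool} → a ∧ not o ≡ true → a ≡ true × o ≡ false
∖-member {true} {false} _ = refl , refl

fixedIn-witness : ∀ {N} (ρ : Fin N → Fin N) C e → 0 < fixedIn ρ C e →
  Σ (Fin N) λ z → C z ≡ true × iter ρ e z ≡ z
fixedIn-witness ρ C e pos with count-witness (λ z → C z ∧ fixes ρ e z) pos
... | z , Cz∧fixed = let Cz , fixed = ∧-member Cz∧fixed in z , Cz , from-does (iter ρ e z ≟ z) fixed

fixedIn-order : ∀ {N} (ρ : Fin N → Fin N) n → (∀ x → iter ρ n x ≡ x) → ∀ A → fixedIn ρ A n ≡ count A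
fixedIn-order ρ n order A =
  count-cong (λ z → trans (cong (A z ∧_) (dec-true (iter ρ n z ≟ z) (order z))) (∧-identityʳ (A z)))

fixCount≡fixedIn : ∀ {N} (σ : Fin N → Fin N) k → fixCount σ k ≡ fixedIn σ (λ _ → true) k
fixCount≡fixedIn σ k = count-filter (λ x → iter σ k x ≟ x) id

fixCount-order : ∀ {L} (ρ : Fin L → Fin L) n → (∀ x → iter ρ n x ≡ x) → fixCount ρ n ≡ L
fixCount-order ρ n order = trans (fixCount≡fixedIn ρ n) (trans (fixedIn-order ρ n order _) (count-full (λ _ → refl)))

module Orbit {N : ℕ} (σ : Fin N → Fin N) (n : ℕ) (1≤n : 1 ≤ n) (order : ∀ x → iter σ n x ≡ x)
             (x₀ : Fin N) (d : ℕ) (per : Iteration.Period σ x₀ d) where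
  open Iteration σ
  open FiniteOrder σ n 1≤n order
  open Period per

  inOrbit : ℕ → Fin N → Bool
  inOrbit zero    z = false
  inOrbit (suc j) z = does (iter σ j x₀ ≟ z) ∨ inOrbit j z

  orbit : Fin N → Bool
  orbit = inOrbit d

  inOrbit⁻ : ∀ j z → inOrbit j z ≡ true → Σ ℕ λ i → i < j × iter σ i x₀ ≡ z
  inOrbit⁻ (suc j) z member with iter σ j x₀ ≟ z
  ... | yes σʲx₀≡z = j , ≤-refl , σʲx₀≡z
  ... | no  _      = let i , i<j , σⁱx₀≡z = inOrbit⁻ j z member in i , m≤n⇒m≤1+n i<j , σⁱx₀≡z

  inOrbit⁺ : ∀ j i → i < j → inOrbit j (iter σ i x₀) ≡ true
  inOrbit⁺ (suc j) i i<1+j with iter σ j x₀ ≟ iter σ i x₀ | m≤n⇒m<n∨m≡n (s≤s⁻¹ i<1+j)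
  ... | yes _ | _         = refl
  ... | no  _ | inj₁ i<j  = inOrbit⁺ j i i<j
  ... | no  ≢ | inj₂ refl = ⊥-elim (≢ refl)

  distinct : ∀ {i j} → i < j → j < d → ¬ (iter σ i x₀ ≡ iter σ j x₀)
  distinct {i} {j} i<j j<d σⁱ≡σʲ =
    minimal (j ∸ i) (m<n⇒0<n∸m i<j) (≤-<-trans (m∸n≤m j i) j<d) (sym (iter-injective i shifted))
    where
    open ≡-Reasoning
    shifted : iter σ i x₀ ≡ iter σ i (iter σ (j ∸ i) x₀)
    shifted = begin
      iter σ i x₀                 ≡⟨ σⁱ≡σʲ ⟩
      iter σ j x₀                 ≡⟨ cong (λ c → iter σ c x₀) (m∸n+n≡m (<⇒≤ i<j)) ⟨
      iter σ (j ∸ i + i) x₀       ≡⟨ iter-+ (j ∸ i) i x₀ ⟩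
      iter σ (j ∸ i) (iter σ i x₀) ≡⟨ iter-comm (j ∸ i) i x₀ ⟩
      iter σ i (iter σ (j ∸ i) x₀) ∎

  count-inOrbit : ∀ j → j ≤ d → count (inOrbit j) ≡ j
  count-inOrbit zero    _     = count-empty {N} (λ _ → refl)
  count-inOrbit (suc j) 1+j≤d = begin
    count (inOrbit (suc j))
      ≡⟨ count-split (inOrbit (suc j)) (inOrbit j) ⟩
    count (inOrbit (suc j) ∖ inOrbit j) + count (λ z → inOrbit (suc j) z ∧ inOrbit j z)
      ≡⟨ cong₂ _+_ (trans (count-cong new) (count-singleton (iter σ j x₀))) (count-cong old) ⟩
    1 + count (inOrbit j)
      ≡⟨ cong suc (count-inOrbit j (≤-trans (n≤1+n j) 1+j≤d)) ⟩
    suc j ∎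
    where
    open ≡-Reasoning
    new : ∀ z → (inOrbit (suc j) ∖ inOrbit j) z ≡ does (iter σ j x₀ ≟ z)
    new z with iter σ j x₀ ≟ z | inOrbit j z in member
    ... | no  _    | true  = refl
    ... | no  _    | false = refl
    ... | yes _    | false = refl
    ... | yes refl | true  = let i , i<j , σⁱ≡σʲ = inOrbit⁻ j _ member in ⊥-elim (distinct i<j 1+j≤d σⁱ≡σʲ)
    old : ∀ z → (inOrbit (suc j) z ∧ inOrbit j z) ≡ inOrbit j z
    old z with does (iter σ j x₀ ≟ z) | inOrbit j z
    ... | true  | true  = refl
    ... | true  | false = refl
    ... | false | true  = refl
    ... | false | false = refl

  orbit-iter : ∀ i → orbit (iter σ i x₀) ≡ true
  orbit-iter i = subst (λ z → orbit z ≡ true) (sym (iter-% d x₀ returns i)) (inOrbit⁺ d (i % d) (m%n<n i d))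
    where instance d≢0 : NonZero d
                   d≢0 = >-nonZero positive

  orbit-invariant : Invariant σ orbit
  orbit-invariant z = bool-⇔ backward forward
    where
    forward : orbit z ≡ true → orbit (σ z) ≡ true
    forward member with inOrbit⁻ d z member
    ... | i , _ , refl = orbit-iter (suc i)
    -- If σ z = σ^i x₀ then z = σ^m (σ z) = σ^(m + i) x₀, where σ^m undoes σ.
    backward : orbit (σ z) ≡ true → orbit z ≡ true
    backward member with inOrbit⁻ d (σ z) member
    ... | i , _ , σⁱx₀≡σz = let m , undo = inverse-power in
      subst (λ w → orbit w ≡ true)
            (trans (iter-+ m i x₀) (trans (cong (iter σ m) σⁱx₀≡σz) (undo z)))
            (orbit-iter (m + i))

  orbit-⊆ : ∀ {A} → Invariant σ A → A x₀ ≡ true → ∀ z → orbit z ≡ true → A z ≡ true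
  orbit-⊆ inv Ax₀ z member with inOrbit⁻ d z member
  ... | i , _ , refl = trans (invariant-iter inv i x₀) Ax₀

  orbit-fixes : ∀ k z → orbit z ≡ true → fixes σ k z ≡ does (d ∣? k)
  orbit-fixes k z member with inOrbit⁻ d z member
  ... | i , _ , refl = does-⇔ (iter σ k (iter σ i x₀) ≟ iter σ i x₀) (d ∣? k)
    (λ fixed → period-∣ k (iter-injective i (trans (iter-comm i k x₀) fixed)))
    (λ d∣k → trans (iter-comm k i x₀) (cong (iter σ i) (∣-period k d∣k)))

  fixedIn-∖orbit : ∀ {A} → Invariant σ A → A x₀ ≡ true → ∀ k →
    fixedIn σ A k ≡ fixedIn σ (A ∖ orbit) k + (if does (d ∣? k) then d else 0)
  fixedIn-∖orbit {A} inv Ax₀ k = begin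
    fixedIn σ A k
      ≡⟨ count-split (λ z → A z ∧ fixes σ k z) orbit ⟩
    count (λ z → (A z ∧ fixes σ k z) ∧ not (orbit z)) + count (λ z → (A z ∧ fixes σ k z) ∧ orbit z)
      ≡⟨ cong₂ _+_ (count-cong outside) (count-cong inside) ⟩
    fixedIn σ (A ∖ orbit) k + count (λ z → does (d ∣? k) ∧ orbit z)
      ≡⟨ cong (fixedIn σ (A ∖ orbit) k +_) (flagged (does (d ∣? k))) ⟩
    fixedIn σ (A ∖ orbit) k + (if does (d ∣? k) then d else 0) ∎
    where
    open ≡-Reasoning
    outside : ∀ z → ((A z ∧ fixes σ k z) ∧ not (orbit z)) ≡ ((A ∖ orbit) z ∧ fixes σ k z)
    outside z with A z | fixes σ k z | orbit z
    ... | false | _     | _     = refl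
    ... | true  | true  | true  = refl
    ... | true  | true  | false = refl
    ... | true  | false | true  = refl
    ... | true  | false | false = refl
    inside : ∀ z → ((A z ∧ fixes σ k z) ∧ orbit z) ≡ (does (d ∣? k) ∧ orbit z)
    inside z with orbit z in member
    ... | false = trans (∧-zeroʳ _) (sym (∧-zeroʳ _))
    ... | true  rewrite orbit-⊆ inv Ax₀ z member | orbit-fixes k z member = refl
    flagged : ∀ b → count (λ z → b ∧ orbit z) ≡ (if b then d else 0)
    flagged true  = count-inOrbit d ≤-refl
    flagged false = count-empty {N} (λ _ → refl)

  module Redefine {B : Set} (φ : Fin N → B) (g : ℕ → B) where
    redefine : ℕ → Fin N → B
    redefine zero    z = φ z
    redefine (suc j) z = if does (iter σ j x₀ ≟ z) then g j else redefine j z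

    redefine-inside : ∀ j i → i < j → j ≤ d → redefine j (iter σ i x₀) ≡ g i
    redefine-inside (suc j) i i<1+j 1+j≤d with iter σ j x₀ ≟ iter σ i x₀ | m≤n⇒m<n∨m≡n (s≤s⁻¹ i<1+j)
    ... | yes σʲ≡σⁱ | inj₁ i<j  = ⊥-elim (distinct i<j 1+j≤d (sym σʲ≡σⁱ))
    ... | yes _     | inj₂ refl = refl
    ... | no  _     | inj₁ i<j  = redefine-inside j i i<j (≤-trans (n≤1+n j) 1+j≤d)
    ... | no  ≢     | inj₂ refl = ⊥-elim (≢ refl)

    redefine-outside : ∀ j z → inOrbit j z ≡ false → redefine j z ≡ φ z
    redefine-outside zero    z _ = refl
    redefine-outside (suc j) z outside with iter σ j x₀ ≟ z
    ... | yes _ with () ← outside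
    ... | no  _ = redefine-outside j z outside

EmbedsAt : ∀ {N M} → (Fin N → Fin N) → (Fin M → Fin M) → (Fin M → Bool) →
  (Fin N → Fin M) → (Fin M → Fin N) → Fin N → Set
EmbedsAt σ τ B φ ψ z = B (φ z) ≡ true × ψ (φ z) ≡ z × φ (σ z) ≡ τ (φ z)

Embeds : ∀ {N M} → (Fin N → Fin N) → (Fin M → Fin M) → (Fin N → Bool) → (Fin M → Bool) →
  (Fin N → Fin M) → (Fin M → Fin N) → Set
Embeds σ τ A B φ ψ = ∀ z → A z ≡ true → EmbedsAt σ τ B φ ψ z

-- An equivariant bijection between the invariant subsets A and B.
Matching : ∀ {N M} → (Fin N → Fin N) → (Fin M → Fin M) → (Fin N → Bool) → (Fin M → Bool) → Set
Matching {N} {M} σ τ A B =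
  Σ (Fin N → Fin M) λ φ → Σ (Fin M → Fin N) λ ψ → Embeds σ τ A B φ ψ × Embeds τ σ B A ψ φ

-- Two orbits of the same size d can be matched by σ^i x₀ ↦ τ^i y₀; this extends any
-- embedding of the complements.
module MatchOrbits {N M : ℕ} (σ : Fin N → Fin N) (τ : Fin M → Fin M) (n : ℕ) (1≤n : 1 ≤ n)
    (order-σ : ∀ x → iter σ n x ≡ x) (order-τ : ∀ y → iter τ n y ≡ y)
    (x₀ : Fin N) (y₀ : Fin M) (d : ℕ)
    (per-x₀ : Iteration.Period σ x₀ d) (per-y₀ : Iteration.Period τ y₀ d) where
  module Ox = Orbit σ n 1≤n order-σ x₀ d per-x₀
  module Oy = Orbit τ n 1≤n order-τ y₀ d per-y₀
  open Iteration

  extend : (Fin N → Fin M) → Fin N → Fin M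
  extend φ = Ox.Redefine.redefine φ (λ i → iter τ i y₀) d

  extend⁻ : (Fin M → Fin N) → Fin M → Fin N
  extend⁻ ψ = Oy.Redefine.redefine ψ (λ i → iter σ i x₀) d

  -- Well defined on all iterates because both points have period d.
  extend-iter : ∀ φ i → extend φ (iter σ i x₀) ≡ iter τ i y₀
  extend-iter φ i = begin
    extend φ (iter σ i x₀)       ≡⟨ cong (extend φ) (iter-% σ d x₀ (Period.returns per-x₀) i) ⟩
    extend φ (iter σ (i % d) x₀) ≡⟨ Ox.Redefine.redefine-inside φ _ d (i % d) (m%n<n i d) ≤-refl ⟩
    iter τ (i % d) y₀            ≡⟨ iter-% τ d y₀ (Period.returns per-y₀) i ⟨
    iter τ i y₀                  ∎
    where
    open ≡-Reasoning
    instance d≢0 : NonZero d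
             d≢0 = >-nonZero (Period.positive per-x₀)

  extend-embeds : ∀ {A B φ ψ} → Invariant τ B → B y₀ ≡ true →
    Embeds σ τ (A ∖ Ox.orbit) (B ∖ Oy.orbit) φ ψ →
    Embeds σ τ A B (extend φ) (extend⁻ ψ)
  extend-embeds {A} {B} {φ} {ψ} inv-B By₀ embeds z Az with Ox.orbit z in onOrbit
  ... | true  = let i , i<d , σⁱx₀≡z = Ox.inOrbit⁻ d z onOrbit in
                subst (EmbedsAt σ τ B (extend φ) (extend⁻ ψ)) σⁱx₀≡z (on-orbit i i<d)
    where
    on-orbit : ∀ i → i < d → EmbedsAt σ τ B (extend φ) (extend⁻ ψ) (iter σ i x₀)
    on-orbit i i<d rewrite extend-iter φ i =
      trans (invariant-iter inv-B i y₀) By₀ ,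
      Oy.Redefine.redefine-inside ψ (λ i → iter σ i x₀) d i i<d ≤-refl ,
      extend-iter φ (suc i)
  ... | false = off-orbit (embeds z (trans (cong (λ o → A z ∧ not o) onOrbit) (cong (_∧ true) Az)))
    where
    φz≡ : extend φ z ≡ φ z
    φz≡ = Ox.Redefine.redefine-outside φ (λ i → iter τ i y₀) d z onOrbit
    off-orbit : EmbedsAt σ τ (B ∖ Oy.orbit) φ ψ z → EmbedsAt σ τ B (extend φ) (extend⁻ ψ) z
    off-orbit (φz∈B∖Oy , ψφz≡z , φσz≡τφz) rewrite φz≡ =
      let Bφz , φz-off = ∖-member φz∈B∖Oy in
      Bφz ,
      trans (Oy.Redefine.redefine-outside ψ (λ i → iter σ i x₀) d (φ z) φz-off) ψφz≡z ,
      trans (Ox.Redefine.redefine-outside φ (λ i → iter τ i y₀) d (σ z) (trans (Ox.orbit-invariant z) onOrbit))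
            φσz≡τφz

-- A point z ∈ A fixed by ρ^d has minimal period d, provided no smaller divisor e of n
-- has any ρ^e-fixed point in A (its minimal period would be such a divisor).
smallest-period : ∀ {N} (ρ : Fin N → Fin N) n → (∀ x → iter ρ n x ≡ x) → ∀ A d → 1 ≤ d →
  (∀ e → e < d → ¬ (1 ≤ e × e ∣ n × 0 < fixedIn ρ A e)) →
  ∀ z → A z ≡ true → iter ρ d z ≡ z → Iteration.Period ρ z d
smallest-period ρ n order A d 1≤d nothing-smaller z Az back = record
  { positive = 1≤d ; returns = back ; minimal = no-return }
  where
  open Iteration ρ
  no-return : ∀ e → 1 ≤ e → e < d → ¬ (iter ρ e z ≡ z)
  no-return e 1≤e e<d backₑ with period-exists _≟_ z e 1≤e backₑ
  ... | p , per = nothing-smaller p (≤-<-trans (∣⇒≤ (Period.period-∣ per e backₑ)) e<d)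
    ( Period.positive per
    , Period.period-∣ per n (order z)
    , count-pos (λ w → A w ∧ fixes ρ p w) z
        (trans (cong (_∧ fixes ρ p z) Az) (dec-true (iter ρ p z ≟ z) (Period.returns per))))
    where instance e≢0 : NonZero e
                   e≢0 = >-nonZero 1≤e

module Classification {N : ℕ} (σ τ : Fin N → Fin N) (n : ℕ) (1≤n : 1 ≤ n)
    (order-σ : ∀ x → iter σ n x ≡ x) (order-τ : ∀ y → iter τ n y ≡ y) where
  open Iteration using (Period)

  SameFixedCounts : (Fin N → Bool) → (Fin N → Bool) → Set
  SameFixedCounts A B = ∀ k → 1 ≤ k → k ∣ n → fixedIn σ A k ≡ fixedIn τ B k

  record CommonOrbit (A B : Fin N → Bool) : Set where
    field
      d      : ℕ
      x₀     : Fin N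
      y₀     : Fin N
      x₀∈A   : A x₀ ≡ true
      y₀∈B   : B y₀ ≡ true
      per-x₀ : Period σ x₀ d
      per-y₀ : Period τ y₀ d

  -- Take d the least divisor of n with a σ^d-fixed point in A (equivalently a τ^d-fixed
  -- point in B); such points of A and B both have minimal period d.
  common-orbit : ∀ {A B} → SameFixedCounts A B → 0 < count A → CommonOrbit A B
  common-orbit {A} {B} same nonempty with least dividing-with-fixed-point? n (1≤n , ∣-refl , fixed-n)
    where
    dividing-with-fixed-point? : ∀ e → Dec (1 ≤ e × e ∣ n × 0 < fixedIn σ A e)
    dividing-with-fixed-point? e = (1 ≤? e) ×-dec ((e ∣? n) ×-dec (0 <? fixedIn σ A e))
    fixed-n : 0 < fixedIn σ A n
    fixed-n = subst (0 <_) (sym (fixedIn-order σ n order-σ A)) nonempty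
  ... | d , (1≤d , d∣n , fixed-σ) , below
    with fixedIn-witness σ A d fixed-σ | fixedIn-witness τ B d (subst (0 <_) (same d 1≤d d∣n) fixed-σ)
  ... | x₀ , x₀∈A , σᵈx₀≡x₀ | y₀ , y₀∈B , τᵈy₀≡y₀ = record
    { d = d ; x₀ = x₀ ; y₀ = y₀ ; x₀∈A = x₀∈A ; y₀∈B = y₀∈B
    ; per-x₀ = smallest-period σ n order-σ A d 1≤d below x₀ x₀∈A σᵈx₀≡x₀
    ; per-y₀ = smallest-period τ n order-τ B d 1≤d below-τ y₀ y₀∈B τᵈy₀≡y₀
    }
    where
    below-τ : ∀ e → e < d → ¬ (1 ≤ e × e ∣ n × 0 < fixedIn τ B e)
    below-τ e e<d (1≤e , e∣n , fixed-e) = below e e<d (1≤e , e∣n , subst (0 <_) (sym (same e 1≤e e∣n)) fixed-e)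

  match-empty : ∀ {A B} → SameFixedCounts A B → count A ≡ 0 → Matching σ τ A B
  match-empty {A} {B} same |A|≡0 =
    id , id , (λ z Az → ⊥-elim (absurd A |A|≡0 z Az)) , (λ z Bz → ⊥-elim (absurd B |B|≡0 z Bz))
    where
    absurd : ∀ C → count C ≡ 0 → ∀ z → C z ≡ true → ⊥
    absurd C |C|≡0 z Cz = <⇒≢ (count-pos C z Cz) (sym |C|≡0)
    |B|≡0 : count B ≡ 0
    |B|≡0 = begin
      count B        ≡⟨ fixedIn-order τ n order-τ B ⟨
      fixedIn τ B n  ≡⟨ same n 1≤n ∣-refl ⟨
      fixedIn σ A n  ≡⟨ fixedIn-order σ n order-σ A ⟩
      count A        ≡⟨ |A|≡0 ⟩
      0              ∎
      where open ≡-Reasoning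

  module PeelOrbit {A B : Fin N → Bool} (inv-A : Invariant σ A) (inv-B : Invariant τ B)
      (same : SameFixedCounts A B) (common : CommonOrbit A B) where
    open CommonOrbit common
    open MatchOrbits σ τ n 1≤n order-σ order-τ x₀ y₀ d per-x₀ per-y₀
    module Reverse = MatchOrbits τ σ n 1≤n order-τ order-σ y₀ x₀ d per-y₀ per-x₀

    A′ B′ : Fin N → Bool
    A′ = A ∖ Ox.orbit
    B′ = B ∖ Oy.orbit

    inv-A′ : Invariant σ A′
    inv-A′ z = cong₂ (λ a o → a ∧ not o) (inv-A z) (Ox.orbit-invariant z)

    inv-B′ : Invariant τ B′
    inv-B′ z = cong₂ (λ b o → b ∧ not o) (inv-B z) (Oy.orbit-invariant z)

    -- Both orbits contribute the same number of σ^k- resp. τ^k-fixed points.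
    same′ : SameFixedCounts A′ B′
    same′ k 1≤k k∣n = +-cancelʳ-≡ _ (fixedIn σ A′ k) (fixedIn τ B′ k) (begin
      fixedIn σ A′ k + _ ≡⟨ Ox.fixedIn-∖orbit inv-A x₀∈A k ⟨
      fixedIn σ A k      ≡⟨ same k 1≤k k∣n ⟩
      fixedIn τ B k      ≡⟨ Oy.fixedIn-∖orbit inv-B y₀∈B k ⟩
      fixedIn τ B′ k + _ ∎)
      where open ≡-Reasoning

    -- |A| = |A′| + d with d ≥ 1.
    shrinks : count A′ < count A
    shrinks = begin-strict
      count A′                                   <⟨ m<m+n (count A′) (Period.positive per-x₀) ⟩
      count A′ + d                               ≡⟨ cong (count A′ +_) (if-divides (dec-true (d ∣? n) d∣n)) ⟨
      count A′ + (if does (d ∣? n) then d else 0) ≡⟨ cong (_+ _) (fixedIn-order σ n order-σ A′) ⟨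
      fixedIn σ A′ n + _                         ≡⟨ Ox.fixedIn-∖orbit inv-A x₀∈A n ⟨
      fixedIn σ A n                              ≡⟨ fixedIn-order σ n order-σ A ⟩
      count A                                    ∎
      where
      open ≤-Reasoning
      d∣n : d ∣ n
      d∣n = Period.period-∣ per-x₀ n (order-σ x₀)
      if-divides : ∀ {b} → b ≡ true → (if b then d else 0) ≡ d
      if-divides refl = refl

    extend-matching : Matching σ τ A′ B′ → Matching σ τ A B
    extend-matching (φ , ψ , φ-embeds , ψ-embeds) =
      extend φ , Reverse.extend ψ , extend-embeds inv-B y₀∈B φ-embeds , Reverse.extend-embeds inv-A x₀∈A ψ-embeds

  match : ∀ fuel {A B} → Invariant σ A → Invariant τ B → SameFixedCounts A B → count A ≤ fuel → Matching σ τ A B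
  match zero       inv-A inv-B same bound = match-empty same (n≤0⇒n≡0 bound)
  match (suc fuel) {A} inv-A inv-B same bound with 0 <? count A
  ... | no  empty    = match-empty same (n≤0⇒n≡0 (≮⇒≥ empty))
  ... | yes nonempty = extend-matching (match fuel inv-A′ inv-B′ same′ (≤-pred (≤-trans shrinks bound)))
    where open PeelOrbit inv-A inv-B same (common-orbit same nonempty)

matching⇒bijection : ∀ {N M} {σ : Fin N → Fin N} {τ : Fin M → Fin M} →
  Matching σ τ (λ _ → true) (λ _ → true) →
  Σ (Fin N ⤖ Fin M) λ ψ → ∀ k x → Bijection.to ψ (iter σ k x) ≡ iter τ k (Bijection.to ψ x)
matching⇒bijection {σ = σ} {τ} (φ , ψ , φ-embeds , ψ-embeds) =
  ↔⇒⤖ (mk↔ₛ′ φ ψ (λ y → proj₁ (proj₂ (ψ-embeds y refl))) (λ x → proj₁ (proj₂ (φ-embeds x refl)))) ,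
  iter-intertwine σ τ φ (λ x → proj₂ (proj₂ (φ-embeds x refl)))

equivariant-bijection : ∀ {N M} (σ : Fin N → Fin N) (τ : Fin M → Fin M) n → 1 ≤ n →
  (∀ x → iter σ n x ≡ x) → (∀ y → iter τ n y ≡ y) →
  (∀ d → 1 ≤ d → d ∣ n → fixCount σ d ≡ fixCount τ d) →
  Σ (Fin N ⤖ Fin M) λ ψ → ∀ k x → Bijection.to ψ (iter σ k x) ≡ iter τ k (Bijection.to ψ x)
equivariant-bijection {N} {M} σ τ n 1≤n order-σ order-τ same-fixCount with sizes
  where
  -- The case d = n compares the sizes of the two sets.
  sizes : N ≡ M
  sizes = trans (sym (fixCount-order σ n order-σ)) (trans (same-fixCount n 1≤n ∣-refl) (fixCount-order τ n order-τ))
... | refl = matching⇒bijection (match N (λ _ → refl) (λ _ → refl) same (≤-reflexive (count-full (λ _ → refl))))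
  where
  open Classification σ τ n 1≤n order-σ order-τ
  same : SameFixedCounts (λ _ → true) (λ _ → true)
  same d 1≤d d∣n = trans (sym (fixCount≡fixedIn σ d)) (trans (same-fixCount d 1≤d d∣n) (fixCount≡fixedIn τ d))

module LyndonFixedPoints (K : CycloDomain) where
  open CycloDomain K
    using (_≈_; 1#; fromℕ; pow; eval; ω; ω-root; charZero; +-cong; *-cong; setoid; +-group)
    renaming (refl to ≈-refl; sym to ≈-sym)
  open import Relation.Binary.Reasoning.Setoid setoid
  open import Algebra.Properties.Group +-group using (∙-cancelˡ)

  fromℕ-injective : ∀ a b → fromℕ a ≈ fromℕ b → a ≡ b
  fromℕ-injective zero    zero    _  = refl
  fromℕ-injective zero    (suc b) eq with () ← charZero (suc b) (≈-sym eq)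
  fromℕ-injective (suc a) zero    eq with () ← charZero (suc a) eq
  fromℕ-injective (suc a) (suc b) eq = cong suc (fromℕ-injective a b (∙-cancelˡ 1# (fromℕ a) (fromℕ b) eq))

  eval-cong : ∀ p {x y} → x ≈ y → eval p x ≈ eval p y
  eval-cong []       x≈y = ≈-refl
  eval-cong (a ∷ as) x≈y = +-cong ≈-refl (*-cong x≈y (eval-cong as x≈y))

  module _ (F : CSPFamily K) (lyndon : LyndonLike F) where
    open CSPFamily F

    fixCount-divisor : ∀ n → 1 ≤ n → ∀ d → 1 ≤ d → d ∣ n → fromℕ (fixCount (act n) d) ≈ fromℕ (size d)
    fixCount-divisor .(0 * d)     () d 1≤d (divides zero refl)
    fixCount-divisor .(suc q * d) 1≤n d 1≤d (divides (suc q) refl) = begin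
      fromℕ (fixCount (act n) d)       ≈⟨ csp n d 1≤n 1≤d (m≤n*m d (suc q)) ⟨
      eval (poly n) (pow (ω n) d)      ≈⟨ lyndon (suc q) d (s≤s z≤n) 1≤d ⟨
      eval (poly d) 1#                 ≈⟨ eval-cong (poly d) (ω-root d 1≤d) ⟨
      eval (poly d) (pow (ω d) d)      ≈⟨ csp d d 1≤d 1≤d ≤-refl ⟩
      fromℕ (fixCount (act d) d)       ≡⟨ cong fromℕ (fixCount-order (act d) d (order d 1≤d)) ⟩
      fromℕ (size d)                   ∎
      where n = suc q * d

  same-fixCount : (F G : CSPFamily K) → LyndonLike F → LyndonLike G →
    (t : ℕ → ℕ) → HasLyndonParams F t → HasLyndonParams G t →
    ∀ n → 1 ≤ n → ∀ d → 1 ≤ d → d ∣ n → fixCount (CSPFamily.act F n) d ≡ fixCount (CSPFamily.act G n) d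
  same-fixCount F G lyndon-F lyndon-G t params-F params-G n 1≤n d 1≤d d∣n =
    fromℕ-injective _ _ (begin
      fromℕ (fixCount (CSPFamily.act F n) d) ≈⟨ fixCount-divisor F lyndon-F n 1≤n d 1≤d d∣n ⟩
      fromℕ (CSPFamily.size F d)             ≡⟨ cong fromℕ (trans (params-F d 1≤d) (sym (params-G d 1≤d))) ⟩
      fromℕ (CSPFamily.size G d)             ≈⟨ fixCount-divisor G lyndon-G n 1≤n d 1≤d d∣n ⟨
      fromℕ (fixCount (CSPFamily.act G n) d) ∎)

proposition7p5 : (K : CycloDomain) (F G : CSPFamily K) →
    LyndonLike F → LyndonLike G →
    (t : ℕ → ℕ) → HasLyndonParams F t → HasLyndonParams G t →
    ∀ n → 1 ≤ n → EquivariantBijection F G n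
proposition7p5 K F G lyndon-F lyndon-G t params-F params-G n 1≤n =
  equivariant-bijection (CSPFamily.act F n) (CSPFamily.act G n) n 1≤n
    (CSPFamily.order F n 1≤n) (CSPFamily.order G n 1≤n)
    (LyndonFixedPoints.same-fixCount K F G lyndon-F lyndon-G t params-F params-G n 1≤n)
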